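{- Let $d\ge 3$, let $G$ be a $d$-degenerate chordal graph with perfect elimination ordering $v_1,\dots,v_n$, let $\alpha,\beta$ be proper $(2d+1)$-colorings of $G$, and let $\mathcal{S}$ be a best choice recoloring sequence for $G$ and this ordering from $\alpha$ to $\beta$. Let $v$ be any vertex of $G$ and let $r$ be the number of steps that are saved for $v$. Then \[ |\mathcal{S}_{|v}| \le 1 + \left\lceil \frac{\sum_{u \in N^-(v)} |\mathcal{S}_{|u}| - r}{d} \right\rceil . \]
   Context: A proper $t$-coloring of $G$ is a map $V(G)\to[t]=\{1,\dots,t\}$ giving adjacent vertices distinct colors. A perfect elimination ordering $v_1,\dots,v_n$ of a chordal graph is one in which, writing $N^-(v_i)=N(v_i)\cap\{v_1,\dots,v_{i-1}\}$, each $N^-(v_i)$ is a clique; for $d$-degenerate chordal $G$ one has $|N^-(v_i)|\le d$. Write $N^-[v]=N^-(v)\cup\{v\}$, $G_i=G[\{v_1,\dots,v_i\}]$. Recoloring sequences: from a coloring $\alpha_0$, a recoloring sequence is $s_1\dots s_m$ with $s_i=(x_i,c_i)$; $\alpha_i$ is obtained from $\alpha_{i-1}$ by giving $x_i$ color $c_i$, and all $\alpha_i$ must be proper. For $X\subseteq V(G)$, $\mathcal{S}_{|X}$ is the subsequence of pairs whose vertex lies in $X$, and $|\mathcal{S}_{|u}|$ is the number of recolorings of $u$ in $\mathcal{S}$. Best choice recoloring sequence: built inductively; $\mathcal{S}_i$ is a recoloring sequence of $G_i$ from $\alpha_{|G_i}$ to $\beta_{|G_i}$ ($\mathcal{S}_0$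 empty), and $\mathcal{S}=\mathcal{S}_n$. To get $\mathcal{S}_i$ from $\mathcal{S}_{i-1}$ (Local Best Choice for $u=v_i$): let $t_1<\dots<t_\ell$ be the steps of $\mathcal{S}_{i-1}$ recoloring a vertex of $N^-(u)$, with new colors $c_{t_1},\dots,c_{t_\ell}$. Starting with $u$ colored $\alpha(u)$, whenever step $t_j$ gives its vertex the current color of $u$, a recoloring of $u$ to its best choice at step $t_j$ is inserted immediately before that step (this recoloring of $u$ is said to be caused by the vertex recolored at $t_j$); no other recolorings of $u$ are made, except that at the very end $u$ is recolored to $\beta(u)$ if needed. A color is valid for $u$ at step $t$ if it differs from the current colors (just before step $t$) of $u$ and of all vertices of $N^-(u)$. The best choice for $u$ at step $t\in\{t_1,\dots,t_\ell\}$ is: $\beta(u)$ if it is valid and distinct from all $c_{t_j}$ with $t_j\ge t$; otherwise any valid color distinct from all $c_{t_j}$ with $t_j\ge t$; otherwise the valid color whose first appearance in the sequence $(c_{t_j})_{t_j\ge t}$ is latest. Saved steps: write $\mathcal{S}_{|N^-[v]}=s'_1\dots s'_m$. Step $i$ is saved for $v$ if $s'_i$ recolors some vertex of $N^-(v)$ and at least one of the following holds: (1) $v$ is not recolored at any of the steps $1,\dots,i$; (2) $v$ is not recolored at any of the steps $i,\dots,m$; (3) $v$ is not recolored at any of the $d$ steps immediately preceding $s'_i$ in $\mathcal{S}_{|N^-[v]}$. -}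

module Defs where

open import Data.Nat using (ℕ; zero; suc; _+_; _*_; _∸_; _≤_; _<_)
open import Data.Nat.DivMod using (_/_)
open import Data.Bool using (Bool; true; false; T; _∧_; _∨_; not; if_then_else_)
open import Data.Fin using (Fin; toℕ; fromℕ<; _≟_; _<?_)
open import Data.List using (List; []; _∷_; map; length; filterᵇ; take; drop; lookup; allFin)
open import Data.Nat.ListAction using (sum)
open import Data.Bool.ListAction using (all)
open import Data.List.Membership.Propositional using (_∈_; _∉_)
open import Data.Product using (Σ; _×_; _,_; proj₁; proj₂; ∃)
open import Data.Sum using (_⊎_)
open import Relation.Nullary using (¬_)
open import Relation.Nullary.Decidable using (⌊_⌋)
open import Relation.Binary.PropositionalEquality using (_≡_; _≢_)

-- Finite simple graph on the vertex set Fin n (Boolean adjacency).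
-- The vertex ordering v_1,...,v_n is the natural order of Fin n (v_{i+1} = i).
record Graph (n : ℕ) : Set where
  field
    adj   : Fin n → Fin n → Bool
    sym   : ∀ x y → adj x y ≡ adj y x
    irrfl : ∀ x → adj x x ≡ false
open Graph public

boolCount : {A : Set} → (A → Bool) → List A → ℕ
boolCount p []       = 0
boolCount p (x ∷ xs) = if p x then suc (boolCount p xs) else boolCount p xs

_==_ : {n : ℕ} → Fin n → Fin n → Bool
x == y = ⌊ x ≟ y ⌋

degIn : {n : ℕ} → Graph n → (Fin n → Bool) → Fin n → ℕ
degIn G X v = boolCount (λ w → X w ∧ adj G v w) (allFin _)

Degenerate : {n : ℕ} → ℕ → Graph n → Set
Degenerate {n} d G = (X : Fin n → Bool) → (∃ λ x → T (X x)) →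
                     ∃ λ v → T (X v) × degIn G X v ≤ d

inN⁻ : {n : ℕ} → Graph n → Fin n → Fin n → Bool
inN⁻ G u w = ⌊ w <? u ⌋ ∧ adj G w u

inN⁻[] : {n : ℕ} → Graph n → Fin n → Fin n → Bool
inN⁻[] G u w = inN⁻ G u w ∨ (w == u)

PEO : {n : ℕ} → Graph n → Set
PEO {n} G = ∀ (u a b : Fin n) → T (inN⁻ G u a) → T (inN⁻ G u b) → a ≢ b → T (adj G a b)

Coloring : ℕ → ℕ → Set
Coloring n t = Fin n → Fin t

Proper : {n t : ℕ} → Graph n → Coloring n t → Set
Proper {n} G c = ∀ (x y : Fin n) → T (adj G x y) → c x ≢ c y

-- a recoloring step (x , c): give vertex x the color c
Step : ℕ → ℕ → Set
Step n t = Fin n × Fin t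

update : {n t : ℕ} → Coloring n t → Fin n → Fin t → Coloring n t
update col x c y = if y == x then c else col y

Valid : {n t : ℕ} → Graph n → Fin n → Coloring n t → Fin t → Set
Valid {n} G u col b = b ≢ col u × (∀ (w : Fin n) → T (inN⁻ G u w) → b ≢ col w)

futureCols : {n t : ℕ} → Graph n → Fin n → List (Step n t) → List (Fin t)
futureCols G u S = map proj₂ (filterᵇ (λ s → inN⁻ G u (proj₁ s)) S)

-- position of the first occurrence of c in a list (length of the list if absent)
firstPos : {t : ℕ} → Fin t → List (Fin t) → ℕ
firstPos c []       = 0
firstPos c (x ∷ xs) = if c == x then 0 else suc (firstPos c xs)

BestChoice : {n t : ℕ} → Graph n → Coloring n t → Fin n → Coloring n t →
             List (Fin t) → Fin t → Set
BestChoice {n} {t} G β u col fut b =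
    (Valid G u col (β u) × β u ∉ fut × b ≡ β u)
  ⊎ ((¬ (Valid G u col (β u) × β u ∉ fut)) × Valid G u col b × b ∉ fut)
  ⊎ ((¬ (Σ (Fin t) λ c → Valid G u col c × c ∉ fut)) × Valid G u col b ×
     (∀ (c : Fin t) → Valid G u col c → firstPos c fut ≤ firstPos b fut))

-- Local Best Choice for u: LBC G β u col S S' means S' is obtained from S by inserting
-- recolorings of u according to the rule, where col is the coloring (of all of G) current
-- just before the remaining sequence S.
data LBC {n t : ℕ} (G : Graph n) (β : Coloring n t) (u : Fin n) :
         Coloring n t → List (Step n t) → List (Step n t) → Set where
  end-ok    : ∀ {col} → col u ≡ β u → LBC G β u col [] []
  end-recol : ∀ {col} → col u ≢ β u → LBC G β u col [] ((u , β u) ∷ [])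
  hit  : ∀ {col x c S S' b} → T (inN⁻ G u x) → c ≡ col u →
         BestChoice G β u col (futureCols G u ((x , c) ∷ S)) b →
         LBC G β u (update (update col u b) x c) S S' →
         LBC G β u col ((x , c) ∷ S) ((u , b) ∷ (x , c) ∷ S')
  pass : ∀ {col x c S S'} → ¬ (T (inN⁻ G u x) × c ≡ col u) →
         LBC G β u (update col x c) S S' →
         LBC G β u col ((x , c) ∷ S) ((x , c) ∷ S')

-- BCS G α β i S : S is a best choice recoloring sequence S_i of G_i (first i vertices)
data BCS {n t : ℕ} (G : Graph n) (α β : Coloring n t) : ℕ → List (Step n t) → Set where
  base : BCS G α β 0 []
  step : ∀ {i S S'} (p : i < n) → BCS G α β i S →
         LBC G β (fromℕ< p) α S S' → BCS G α β (suc i) S'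

restrict : {n t : ℕ} → (Fin n → Bool) → List (Step n t) → List (Step n t)
restrict X S = filterᵇ (λ s → X (proj₁ s)) S

recolCount : {n t : ℕ} → Fin n → List (Step n t) → ℕ
recolCount u S = length (restrict (λ w → w == u) S)

sumN⁻ : {n t : ℕ} → Graph n → Fin n → List (Step n t) → ℕ
sumN⁻ {n} G v S = sum (map (λ u → if inN⁻ G v u then recolCount u S else 0) (allFin n))

noV : {n t : ℕ} → Fin n → List (Step n t) → Bool
noV v L = all (λ s → not (proj₁ s == v)) L

-- step at 0-based position j (i.e. step j+1) with entry s of L = S_{|N⁻[v]} is saved for v
savedAt : {n t : ℕ} → Graph n → ℕ → Fin n → List (Step n t) → ℕ → Step n t → Bool
savedAt G d v L j s =
  inN⁻ G v (proj₁ s) ∧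
    (noV v (take (suc j) L) ∨ noV v (drop j L) ∨ noV v (drop (j ∸ d) (take j L)))

savedCount : {n t : ℕ} → Graph n → ℕ → Fin n → List (Step n t) → ℕ
savedCount G d v S =
  boolCount (λ i → savedAt G d v L (toℕ i) (lookup L i)) (allFin (length L))
  where L = restrict (inN⁻[] G v) S

ceilDiv : ℕ → ℕ → ℕ
ceilDiv a zero    = 0
ceilDiv a (suc k) = (a + k) / suc k

{-# OPTIONS --safe #-}
-- Restricted to N⁻[v], the best choice sequence is the output of the local best choice rule for v,
-- run on a sequence without recolourings of v: later vertices only insert recolourings of
-- themselves. That output is a block of neighbour steps followed by the recolourings of v, and two
-- consecutive ones are at least d neighbour steps apart unless the later one is the final
-- recolouring to β v. Indeed, if the colour b chosen for v is hit again by a neighbour, b was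
-- chosen by the last rule; as v has at most d earlier neighbours (degeneracy, N⁻[v] being a
-- clique), each of the 2d + 1 colours is blocked or appears among the future neighbour colours no
-- later than b, so b first reappears at least d − 1 steps later. The first d steps of each gap are
-- not saved, since v is recoloured before, after and within the d steps preceding them; hence k
-- recolourings of v leave at least d (k − 2) + 1 unsaved neighbour steps when k ≥ 2.
module Submission where

open import Defs hiding (sym)
open import Data.Nat using (ℕ; _+_; _*_; _∸_; _≤_)
open import Data.List using (List)

open import Data.Bool using (Bool; true; false; T; T?; _∧_; _∨_; not; if_then_else_)
open import Data.Bool.Properties using (if-eta; ∧-zeroʳ)
open import Data.Empty using (⊥-elim)
open import Data.Fin using (Fin; toℕ; fromℕ<)
import Data.Fin as Fin
open import Data.Fin.Properties using (toℕ-injective; toℕ-fromℕ<; toℕ<n; injective⇒≤)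
open import Data.List using ([]; _∷_; _++_; map; length; filterᵇ; take; drop; lookup; allFin)
open import Data.List.Properties
  using (map-tabulate; filter-accept; filter-reject; length-++; length-map; length-take; ++-assoc)
open import Data.List.Membership.Propositional using (_∈_; _∉_)
open import Data.List.Membership.Propositional.Properties
  using (∈-map⁺; ∈-filter⁺; ∈-allFin; ∈-++⁺ˡ; ∈-++⁺ʳ)
open import Data.List.Relation.Unary.All using (All; []; _∷_)
import Data.List.Relation.Unary.All as All
open import Data.List.Relation.Unary.All.Properties using (++⁺)
open import Data.List.Relation.Unary.Any using (Any; here; there)
import Data.List.Relation.Unary.Any as Any
open import Data.List.Relation.Unary.Any.Properties using (lookup-index)
open import Data.Nat using (zero; suc; _<_; _⊓_; z≤n; s≤s; s≤s⁻¹)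
import Data.Nat as ℕ
open import Data.Nat.DivMod using (_/_; /-monoˡ-≤; m/n≡1+[m∸n]/n; m≥n⇒m/n>0)
open import Data.Nat.ListAction using (sum)
open import Data.Nat.Properties
open import Algebra.Properties.CommutativeMonoid.Sum +-0-commutativeMonoid
  using (sum-syntax; ∑-distrib-+; sum-cong-≗; sum-replicate-zero)
  renaming (sum to ∑)
open import Algebra.Properties.CommutativeSemigroup +-commutativeSemigroup using (interchange)
open import Data.Product using (Σ; _×_; _,_; proj₁; proj₂)
open import Data.Sum using (_⊎_; inj₁; inj₂)
open import Function using (_∘_; id)
open import Relation.Binary.PropositionalEquality
  using (_≡_; _≢_; refl; sym; trans; cong; cong₂; subst; subst₂; module ≡-Reasoning)
open import Relation.Nullary using (¬_; Dec; yes; no)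
open import Relation.Nullary.Decidable using (toWitness; fromWitness; decidable-stable)

𝟙 : Bool → ℕ
𝟙 b = if b then 1 else 0

𝟙-∧-split : ∀ a b → 𝟙 (a ∧ b) + 𝟙 (a ∧ not (a ∧ b)) ≡ 𝟙 a
𝟙-∧-split true  true  = refl
𝟙-∧-split true  false = refl
𝟙-∧-split false _     = refl

T-∧-intro : ∀ {a b} → T a → T b → T (a ∧ b)
T-∧-intro {true} _ tb = tb

T-∨-introˡ : ∀ {a} b → T a → T (a ∨ b)
T-∨-introˡ {true} _ _ = _

T-∨-introʳ : ∀ a {b} → T b → T (a ∨ b)
T-∨-introʳ true  _  = _
T-∨-introʳ false tb = tb

T-∨-elim : ∀ a {b} → T (a ∨ b) → T a ⊎ T b
T-∨-elim true  _  = inj₁ _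
T-∨-elim false tb = inj₂ tb

module _ {m : ℕ} {x y : Fin m} where

  ==⇒≡ : T (x == y) → x ≡ y
  ==⇒≡ = toWitness {a? = x Fin.≟ y}

  ≡⇒== : x ≡ y → T (x == y)
  ≡⇒== = fromWitness {a? = x Fin.≟ y}

==-refl : ∀ {m} (x : Fin m) → (x == x) ≡ true
==-refl x with x == x in eq
... | true  = refl
... | false = ⊥-elim (subst T eq (≡⇒== refl))

==-suc : ∀ {m} (w u : Fin m) → (Fin.suc w == Fin.suc u) ≡ (w == u)
==-suc w u with w Fin.≟ u
... | yes _ = refl
... | no  _ = refl

-- Counting

module _ {A : Set} where

  boolCount-∷ : ∀ (p : A → Bool) x xs → boolCount p (x ∷ xs) ≡ 𝟙 (p x) + boolCount p xs
  boolCount-∷ p x xs with p x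
  ... | true  = refl
  ... | false = refl

  boolCount-++ : ∀ (p : A → Bool) xs ys →
                 boolCount p (xs ++ ys) ≡ boolCount p xs + boolCount p ys
  boolCount-++ p []       ys = refl
  boolCount-++ p (x ∷ xs) ys = begin
    boolCount p (x ∷ xs ++ ys)                 ≡⟨ boolCount-∷ p x (xs ++ ys) ⟩
    𝟙 (p x) + boolCount p (xs ++ ys)           ≡⟨ cong (𝟙 (p x) +_) (boolCount-++ p xs ys) ⟩
    𝟙 (p x) + (boolCount p xs + boolCount p ys) ≡⟨ +-assoc (𝟙 (p x)) _ _ ⟨
    𝟙 (p x) + boolCount p xs + boolCount p ys   ≡⟨ cong (_+ boolCount p ys) (boolCount-∷ p x xs) ⟨
    boolCount p (x ∷ xs) + boolCount p ys       ∎
    where open ≡-Reasoning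

  boolCount≡sum : ∀ (p : A → Bool) xs → boolCount p xs ≡ sum (map (𝟙 ∘ p) xs)
  boolCount≡sum p []       = refl
  boolCount≡sum p (x ∷ xs) = trans (boolCount-∷ p x xs) (cong (𝟙 (p x) +_) (boolCount≡sum p xs))

  length-filterᵇ : ∀ (p : A → Bool) xs → length (filterᵇ p xs) ≡ boolCount p xs
  length-filterᵇ p [] = refl
  length-filterᵇ p (x ∷ xs) with p x
  ... | true  = cong suc (length-filterᵇ p xs)
  ... | false = length-filterᵇ p xs

  boolCount-filterᵇ : ∀ {p q : A → Bool} → (∀ x → T (p x) → T (q x)) →
                      ∀ xs → boolCount p (filterᵇ q xs) ≡ boolCount p xs
  boolCount-filterᵇ p⇒q [] = refl
  boolCount-filterᵇ {p} {q} p⇒q (x ∷ xs) with q x in qx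
  ... | true  = begin
    boolCount p (x ∷ filterᵇ q xs)        ≡⟨ boolCount-∷ p x (filterᵇ q xs) ⟩
    𝟙 (p x) + boolCount p (filterᵇ q xs)  ≡⟨ cong (𝟙 (p x) +_) (boolCount-filterᵇ p⇒q xs) ⟩
    𝟙 (p x) + boolCount p xs              ≡⟨ boolCount-∷ p x xs ⟨
    boolCount p (x ∷ xs)                  ∎
    where open ≡-Reasoning
  ... | false with p x in px
  ...   | true  = ⊥-elim (subst T qx (p⇒q x (subst T (sym px) _)))
  ...   | false = boolCount-filterᵇ p⇒q xs

  boolCount-mono : ∀ {p q : A → Bool} → (∀ x → T (p x) → T (q x)) →
                   ∀ xs → boolCount p xs ≤ boolCount q xs
  boolCount-mono p⇒q [] = z≤n
  boolCount-mono {p} {q} p⇒q (x ∷ xs) with p x in px | q x in qx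
  ... | true  | true  = s≤s (boolCount-mono p⇒q xs)
  ... | true  | false = ⊥-elim (subst T qx (p⇒q x (subst T (sym px) _)))
  ... | false | true  = m≤n⇒m≤1+n (boolCount-mono p⇒q xs)
  ... | false | false = boolCount-mono p⇒q xs

  boolCount-none : ∀ {p : A → Bool} {xs} → All (λ x → ¬ T (p x)) xs → boolCount p xs ≡ 0
  boolCount-none [] = refl
  boolCount-none {p} {x ∷ xs} (¬px ∷ ¬pxs) with p x
  ... | true  = ⊥-elim (¬px _)
  ... | false = boolCount-none ¬pxs

  boolCount-∨ : ∀ (p q : A → Bool) xs →
                boolCount (λ x → p x ∨ q x) xs ≤ boolCount p xs + boolCount q xs
  boolCount-∨ p q [] = z≤n
  boolCount-∨ p q (x ∷ xs) with p x | q x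
  ... | true  | true  = s≤s (≤-trans (boolCount-∨ p q xs) (≤-trans (n≤1+n _) (≤-reflexive (sym (+-suc _ _)))))
  ... | true  | false = s≤s (boolCount-∨ p q xs)
  ... | false | true  = ≤-trans (s≤s (boolCount-∨ p q xs)) (≤-reflexive (sym (+-suc _ _)))
  ... | false | false = boolCount-∨ p q xs

  boolCount-∨-disjoint : ∀ {p q : A → Bool} → (∀ x → T (p x) → ¬ T (q x)) →
                         ∀ xs → boolCount (λ x → p x ∨ q x) xs ≡ boolCount p xs + boolCount q xs
  boolCount-∨-disjoint disj [] = refl
  boolCount-∨-disjoint {p} {q} disj (x ∷ xs) with p x in px | q x in qx
  ... | true  | true  = ⊥-elim (disj x (subst T (sym px) _) (subst T (sym qx) _))
  ... | true  | false = cong suc (boolCount-∨-disjoint disj xs)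
  ... | false | true  = trans (cong suc (boolCount-∨-disjoint disj xs)) (sym (+-suc _ _))
  ... | false | false = boolCount-∨-disjoint disj xs

  countFrom : (ℕ → A → Bool) → ℕ → List A → ℕ
  countFrom p i []       = 0
  countFrom p i (x ∷ xs) = 𝟙 (p i x) + countFrom p (suc i) xs

  countFrom-suc : ∀ (p : ℕ → A → Bool) i xs → countFrom (p ∘ suc) i xs ≡ countFrom p (suc i) xs
  countFrom-suc p i []       = refl
  countFrom-suc p i (x ∷ xs) = cong (𝟙 (p (suc i) x) +_) (countFrom-suc p (suc i) xs)

  countFrom-++ : ∀ (p : ℕ → A → Bool) i xs ys →
                 countFrom p i (xs ++ ys) ≡ countFrom p i xs + countFrom p (i + length xs) ys
  countFrom-++ p i []       ys = cong (λ j → countFrom p j ys) (sym (+-identityʳ i))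
  countFrom-++ p i (x ∷ xs) ys = begin
    𝟙 (p i x) + countFrom p (suc i) (xs ++ ys)
      ≡⟨ cong (𝟙 (p i x) +_) (countFrom-++ p (suc i) xs ys) ⟩
    𝟙 (p i x) + (countFrom p (suc i) xs + countFrom p (suc i + length xs) ys)
      ≡⟨ +-assoc (𝟙 (p i x)) _ _ ⟨
    𝟙 (p i x) + countFrom p (suc i) xs + countFrom p (suc i + length xs) ys
      ≡⟨ cong (λ j → 𝟙 (p i x) + countFrom p (suc i) xs + countFrom p j ys) (+-suc i (length xs)) ⟨
    𝟙 (p i x) + countFrom p (suc i) xs + countFrom p (i + length (x ∷ xs)) ys
      ∎
    where open ≡-Reasoning

  countFrom-∷-++ : ∀ (p : ℕ → A → Bool) i x xs ys →
                   countFrom p (suc i) xs + countFrom p (suc i + length xs) ys ≤ countFrom p i (x ∷ xs ++ ys)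
  countFrom-∷-++ p i x xs ys = begin
    countFrom p (suc i) xs + countFrom p (suc i + length xs) ys   ≡⟨ countFrom-++ p (suc i) xs ys ⟨
    countFrom p (suc i) (xs ++ ys)                               ≤⟨ m≤n+m _ (𝟙 (p i x)) ⟩
    countFrom p i (x ∷ xs ++ ys)                                 ∎
    where open ≤-Reasoning

  countFrom-const : ∀ (p : A → Bool) i xs → countFrom (λ _ → p) i xs ≡ boolCount p xs
  countFrom-const p i []       = refl
  countFrom-const p i (x ∷ xs) =
    trans (cong (𝟙 (p x) +_) (countFrom-const p (suc i) xs)) (sym (boolCount-∷ p x xs))

  countFrom-+ : ∀ {p q r : ℕ → A → Bool} → (∀ j x → 𝟙 (p j x) + 𝟙 (q j x) ≡ 𝟙 (r j x)) →
                ∀ i xs → countFrom p i xs + countFrom q i xs ≡ countFrom r i xs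
  countFrom-+ split i []       = refl
  countFrom-+ {p} {q} split i (x ∷ xs) =
    trans (interchange (𝟙 (p i x)) (countFrom p (suc i) xs) (𝟙 (q i x)) (countFrom q (suc i) xs))
          (cong₂ _+_ (split i x) (countFrom-+ split (suc i) xs))

  countFrom-≥ : ∀ {Q : A → Set} {p : ℕ → A → Bool} {e i xs} → All Q xs →
                (∀ {m x} → m < e → m < length xs → Q x → T (p (i + m) x)) →
                e ⊓ length xs ≤ countFrom p i xs
  countFrom-≥ {e = e}     {xs = []}     []         _ = ≤-reflexive (⊓-zeroʳ e)
  countFrom-≥ {e = zero}  {xs = x ∷ xs} _          _ = z≤n
  countFrom-≥ {p = p} {e = suc e} {i} {x ∷ xs} (qx ∷ qxs) unsaved
    with p i x | subst (λ j → T (p j x)) (+-identityʳ i) (unsaved (s≤s z≤n) (s≤s z≤n) qx)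
  ... | true | _ = s≤s (countFrom-≥ qxs λ {m} {y} m<e m<l qy →
                     subst (λ j → T (p j y)) (+-suc i m) (unsaved (s≤s m<e) (s≤s m<l) qy))

map-allFin-suc : ∀ {m} {B : Set} (f : Fin (suc m) → B) →
                 map f (allFin (suc m)) ≡ f Fin.zero ∷ map (f ∘ Fin.suc) (allFin m)
map-allFin-suc f =
  cong (f Fin.zero ∷_) (trans (map-tabulate Fin.suc f) (sym (map-tabulate id (f ∘ Fin.suc))))

sum-map-allFin : ∀ {m} (f : Fin m → ℕ) → sum (map f (allFin m)) ≡ ∑[ i < m ] f i
sum-map-allFin {zero}  f = refl
sum-map-allFin {suc m} f =
  trans (cong sum (map-allFin-suc f)) (cong (f Fin.zero +_) (sum-map-allFin (f ∘ Fin.suc)))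

boolCount-allFin : ∀ {m} (p : Fin m → Bool) → boolCount p (allFin m) ≡ ∑[ i < m ] 𝟙 (p i)
boolCount-allFin p = trans (boolCount≡sum p (allFin _)) (sum-map-allFin (𝟙 ∘ p))

∑-𝟙-== : ∀ {m} (w : Fin m) → ∑[ u < m ] 𝟙 (w == u) ≡ 1
∑-𝟙-== {suc m} Fin.zero    = cong suc (sum-replicate-zero m)
∑-𝟙-== {suc m} (Fin.suc w) = trans (sum-cong-≗ (cong 𝟙 ∘ ==-suc w)) (∑-𝟙-== w)

∑-lookup : ∀ {A : Set} (p : ℕ → A → Bool) xs →
           ∑[ k < length xs ] 𝟙 (p (toℕ k) (lookup xs k)) ≡ countFrom p 0 xs
∑-lookup p []       = refl
∑-lookup p (x ∷ xs) = cong (𝟙 (p 0 x) +_) (trans (∑-lookup (p ∘ suc) xs) (countFrom-suc p 0 xs))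

count-== : ∀ {m} (w : Fin m) → boolCount (w ==_) (allFin m) ≡ 1
count-== w = trans (boolCount-allFin (w ==_)) (∑-𝟙-== w)

module _ {n t : ℕ} where

  recolCount-∷ : ∀ (u x : Fin n) (c : Fin t) S →
                 recolCount u ((x , c) ∷ S) ≡ 𝟙 (x == u) + recolCount u S
  recolCount-∷ u x c S = begin
    recolCount u ((x , c) ∷ S)                           ≡⟨ length-filterᵇ isU ((x , c) ∷ S) ⟩
    boolCount isU ((x , c) ∷ S)                          ≡⟨ boolCount-∷ isU (x , c) S ⟩
    𝟙 (x == u) + boolCount isU S                         ≡⟨ cong (𝟙 (x == u) +_) (length-filterᵇ isU S) ⟨
    𝟙 (x == u) + recolCount u S                          ∎
    where
    open ≡-Reasoning
    isU : Step n t → Bool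
    isU s = proj₁ s == u

  ∑-recolCount : ∀ (X : Fin n → Bool) (S : List (Step n t)) →
                 ∑[ u < n ] (if X u then recolCount u S else 0) ≡ boolCount (X ∘ proj₁) S
  ∑-recolCount X [] = trans (sum-cong-≗ (λ u → if-eta (X u))) (sum-replicate-zero n)
  ∑-recolCount X ((x , c) ∷ S) = begin
    ∑[ u < n ] (if X u then recolCount u ((x , c) ∷ S) else 0)
      ≡⟨ sum-cong-≗ split ⟩
    ∑[ u < n ] (𝟙 (X u ∧ (x == u)) + (if X u then recolCount u S else 0))
      ≡⟨ ∑-distrib-+ (λ u → 𝟙 (X u ∧ (x == u))) _ ⟩
    ∑[ u < n ] 𝟙 (X u ∧ (x == u)) + ∑[ u < n ] (if X u then recolCount u S else 0)
      ≡⟨ cong₂ _+_ (trans (sum-cong-≗ (cong 𝟙 ∘ at-x)) (∑-at-x (X x))) (∑-recolCount X S) ⟩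
    𝟙 (X x) + boolCount (X ∘ proj₁) S
      ≡⟨ boolCount-∷ (X ∘ proj₁) (x , c) S ⟨
    boolCount (X ∘ proj₁) ((x , c) ∷ S)
      ∎
    where
    open ≡-Reasoning
    split : ∀ u → (if X u then recolCount u ((x , c) ∷ S) else 0)
                  ≡ 𝟙 (X u ∧ (x == u)) + (if X u then recolCount u S else 0)
    split u with X u
    ... | true  = recolCount-∷ u x c S
    ... | false = refl
    at-x : ∀ u → (X u ∧ (x == u)) ≡ (X x ∧ (x == u))
    at-x u with x Fin.≟ u
    ... | yes refl = refl
    ... | no  _    = trans (∧-zeroʳ (X u)) (sym (∧-zeroʳ (X x)))
    ∑-at-x : ∀ b → ∑[ u < n ] 𝟙 (b ∧ (x == u)) ≡ 𝟙 b
    ∑-at-x true  = ∑-𝟙-== x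
    ∑-at-x false = sum-replicate-zero n

-- Earlier neighbourhoods

module _ {n : ℕ} (G : Graph n) where

  inN⁻⇒< : ∀ {v x} → T (inN⁻ G v x) → toℕ x < toℕ v
  inN⁻⇒< {v} {x} x∈ with x Fin.<? v
  ... | yes x<v = x<v

  inN⁻⇒adj : ∀ {v x} → T (inN⁻ G v x) → T (adj G x v)
  inN⁻⇒adj {v} {x} x∈ with x Fin.<? v
  ... | yes _ = x∈

  inN⁻⇒≢ : ∀ {v x} → T (inN⁻ G v x) → x ≢ v
  inN⁻⇒≢ x∈ refl = <-irrefl refl (inN⁻⇒< x∈)

  inN⁻⇒inN⁻[] : ∀ {v x} → T (inN⁻ G v x) → T (inN⁻[] G v x)
  inN⁻⇒inN⁻[] {v} {x} x∈ with inN⁻ G v x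
  ... | true = _

  inN⁻[]-self : ∀ v → T (inN⁻[] G v v)
  inN⁻[]-self v with inN⁻ G v v
  ... | true  = _
  ... | false = ≡⇒== refl

  inN⁻[]-cases : ∀ {v x} → T (inN⁻[] G v x) → T (inN⁻ G v x) ⊎ x ≡ v
  inN⁻[]-cases {v} {x} x∈ with T-∨-elim (inN⁻ G v x) x∈
  ... | inj₁ x∈⁻  = inj₁ x∈⁻
  ... | inj₂ x==v = inj₂ (==⇒≡ x==v)

  inN⁻[]⇒≤ : ∀ {v x} → T (inN⁻[] G v x) → toℕ x ≤ toℕ v
  inN⁻[]⇒≤ {v} {x} x∈ with inN⁻[]-cases {v} {x} x∈
  ... | inj₁ x∈⁻  = <⇒≤ (inN⁻⇒< x∈⁻)
  ... | inj₂ refl = ≤-refl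

  -- Since N⁻[v] is a clique, a vertex w ≠ v of it is adjacent to v and to the rest of N⁻(v).
  |N⁻|≤degIn : PEO G → ∀ {v w} → T (inN⁻[] G v w) →
               boolCount (inN⁻ G v) (allFin n) ≤ degIn G (inN⁻[] G v) w
  |N⁻|≤degIn peo {v} {w} w∈ with inN⁻[]-cases {v} {w} w∈
  ... | inj₂ refl = boolCount-mono
    (λ u u∈ → T-∧-intro (inN⁻⇒inN⁻[] u∈) (subst T (Graph.sym G u v) (inN⁻⇒adj u∈))) (allFin n)
  ... | inj₁ w∈⁻  = +-cancelʳ-≤ 1 _ _ (begin
    boolCount N all + 1                                   ≡⟨ cong (boolCount N all +_) (count-== v) ⟨
    boolCount N all + boolCount (v ==_) all               ≡⟨ boolCount-∨-disjoint N∌v all ⟨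
    boolCount (λ u → N u ∨ (v == u)) all                  ≤⟨ boolCount-mono exchange all ⟩
    boolCount (λ u → (X u ∧ adj G w u) ∨ (w == u)) all    ≤⟨ boolCount-∨ _ (w ==_) all ⟩
    degIn G X w + boolCount (w ==_) all                   ≡⟨ cong (degIn G X w +_) (count-== w) ⟩
    degIn G X w + 1                                       ∎)
    where
    open ≤-Reasoning
    all = allFin n
    N X : Fin n → Bool
    N = inN⁻ G v
    X = inN⁻[] G v
    N∌v : ∀ u → T (N u) → ¬ T (v == u)
    N∌v u u∈ v==u = inN⁻⇒≢ u∈ (sym (==⇒≡ v==u))
    exchange : ∀ u → T (N u ∨ (v == u)) → T ((X u ∧ adj G w u) ∨ (w == u))
    exchange u u∈ with T-∨-elim (N u) u∈ | w Fin.≟ u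
    ... | _         | yes _   = T-∨-introʳ (X u ∧ adj G w u) _
    ... | inj₁ u∈⁻  | no  w≢u = T-∨-introˡ false (T-∧-intro (inN⁻⇒inN⁻[] u∈⁻) (peo v w u w∈⁻ u∈⁻ w≢u))
    ... | inj₂ v==u | no  _   with ==⇒≡ {x = v} {y = u} v==u
    ...   | refl = T-∨-introˡ false (T-∧-intro (inN⁻[]-self v) (inN⁻⇒adj w∈⁻))

  |N⁻|≤d : ∀ {d} → Degenerate d G → PEO G → ∀ v → boolCount (inN⁻ G v) (allFin n) ≤ d
  |N⁻|≤d deg peo v with deg (inN⁻[] G v) (v , inN⁻[]-self v)
  ... | w , w∈ , degIn≤d = ≤-trans (|N⁻|≤degIn peo w∈) degIn≤d

-- Restriction to N⁻[v]

module _ {n t : ℕ} (X : Fin n → Bool) {x : Fin n} {c : Fin t} where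

  restrict-accept : ∀ S → T (X x) → restrict X ((x , c) ∷ S) ≡ (x , c) ∷ restrict X S
  restrict-accept S Xx = filter-accept (T? ∘ X ∘ proj₁) Xx

  restrict-reject : ∀ S → ¬ T (X x) → restrict X ((x , c) ∷ S) ≡ restrict X S
  restrict-reject S ¬Xx = filter-reject (T? ∘ X ∘ proj₁) ¬Xx

module _ {n t : ℕ} where

  restrict-∷-cong : ∀ (X : Fin n → Bool) (s : Step n t) {S₁ S₂} →
                    restrict X S₁ ≡ restrict X S₂ → restrict X (s ∷ S₁) ≡ restrict X (s ∷ S₂)
  restrict-∷-cong X (x , c) eq with X x
  ... | true  = cong ((x , c) ∷_) eq
  ... | false = eq

  module _ (G : Graph n) (β : Coloring n t) where

    LBC-All : ∀ {P : Step n t → Set} {u col S S'} → (∀ c → P (u , c)) →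
              LBC G β u col S S' → All P S → All P S'
    LBC-All Pu (end-ok _)    []         = []
    LBC-All Pu (end-recol _) []         = Pu _ ∷ []
    LBC-All Pu (hit _ _ _ D) (px ∷ pxs) = Pu _ ∷ px ∷ LBC-All Pu D pxs
    LBC-All Pu (pass _ D)    (px ∷ pxs) = px ∷ LBC-All Pu D pxs

    LBC-restrict : ∀ (X : Fin n → Bool) {u col S S'} → ¬ T (X u) →
                   LBC G β u col S S' → restrict X S' ≡ restrict X S
    LBC-restrict X ¬Xu (end-ok _)    = refl
    LBC-restrict X ¬Xu (end-recol _) = restrict-reject X [] ¬Xu
    LBC-restrict X ¬Xu (hit {x = x} {c = c} {S' = S'} _ _ _ D) =
      trans (restrict-reject X ((x , c) ∷ S') ¬Xu) (restrict-∷-cong X (x , c) (LBC-restrict X ¬Xu D))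
    LBC-restrict X ¬Xu (pass {x = x} {c = c} _ D) = restrict-∷-cong X (x , c) (LBC-restrict X ¬Xu D)

  record LocalRun (G : Graph n) (α β : Coloring n t) (v : Fin n) (S : List (Step n t)) : Set where
    field
      input output  : List (Step n t)
      run           : LBC G β v α input output
      input-avoids  : All (λ s → proj₁ s ≢ v) input
      restrict-≡    : restrict (inN⁻[] G v) S ≡ restrict (inN⁻[] G v) output

  module _ (G : Graph n) (α β : Coloring n t) where

    BCS-vertices< : ∀ {k S} → BCS G α β k S → All (λ s → toℕ (proj₁ s) < k) S
    BCS-vertices< base = []
    BCS-vertices< (step {i} p B D) =
      LBC-All G β (λ _ → ≤-reflexive (cong suc (toℕ-fromℕ< p))) D (All.map m<n⇒m<1+n (BCS-vertices< B))

    -- Later vertices only insert recolourings of themselves, which lie outside N⁻[v].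
    BCS-localRun : ∀ (v : Fin n) {k S} → BCS G α β k S → toℕ v < k → LocalRun G α β v S
    BCS-localRun v (step {i} {S₀} {S₁} p B D) v<1+i with toℕ v ℕ.≟ i
    ... | yes refl = record
      { input        = S₀
      ; output       = S₁
      ; run          = subst (λ u → LBC G β u α S₀ S₁) (toℕ-injective (toℕ-fromℕ< p)) D
      ; input-avoids = All.map (λ { x<v refl → <-irrefl refl x<v }) (BCS-vertices< B)
      ; restrict-≡   = refl
      }
    ... | no v≢i = record
      { input        = input
      ; output       = output
      ; run          = run
      ; input-avoids = input-avoids
      ; restrict-≡   = trans (LBC-restrict G β (inN⁻[] G v) (v-earlier ∘ inN⁻[]⇒≤ G) D) restrict-≡
      }
      where
      v<i = ≤∧≢⇒< (s≤s⁻¹ v<1+i) v≢i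
      open LocalRun (BCS-localRun v B v<i)
      v-earlier : ¬ (toℕ (fromℕ< p) ≤ toℕ v)
      v-earlier = <⇒≱ (subst (toℕ v <_) (sym (toℕ-fromℕ< p)) v<i)

-- Best choices

enumerates⇒≤length : ∀ {m} (xs : List (Fin m)) → (∀ i → i ∈ xs) → m ≤ length xs
enumerates⇒≤length xs ∈xs = injective⇒≤ {f = λ i → Any.index (∈xs i)} λ {i} {j} eq → begin
  i                             ≡⟨ lookup-index (∈xs i) ⟩
  lookup xs (Any.index (∈xs i)) ≡⟨ cong (lookup xs) eq ⟩
  lookup xs (Any.index (∈xs j)) ≡⟨ lookup-index (∈xs j) ⟨
  j                             ∎
  where open ≡-Reasoning

module _ {t : ℕ} {c : Fin t} where

  ∈-∷-≢ : ∀ {c' xs} → c ∈ c' ∷ xs → c ≢ c' → c ∈ xs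
  ∈-∷-≢ (here c≡c') c≢c' = ⊥-elim (c≢c' c≡c')
  ∈-∷-≢ (there c∈)  _    = c∈

  firstPos-here : ∀ {c'} xs → c ≡ c' → firstPos c (c' ∷ xs) ≡ 0
  firstPos-here {c'} xs c≡c' with c == c' in eq
  ... | true  = refl
  ... | false = ⊥-elim (subst T eq (≡⇒== c≡c'))

  firstPos-there : ∀ {c'} xs → c ≢ c' → firstPos c (c' ∷ xs) ≡ suc (firstPos c xs)
  firstPos-there {c'} xs c≢c' with c == c' in eq
  ... | true  = ⊥-elim (c≢c' (==⇒≡ (subst T (sym eq) _)))
  ... | false = refl

  ∈-take-firstPos : ∀ xs m → c ∈ xs → firstPos c xs ≤ m → c ∈ take (suc m) xs
  ∈-take-firstPos (y ∷ ys) m c∈ c≤m with c Fin.≟ y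
  ... | yes c≡y = here c≡y
  ∈-take-firstPos (y ∷ ys) (suc m) (here c≡y)  (s≤s c≤m) | no c≢y = ⊥-elim (c≢y c≡y)
  ∈-take-firstPos (y ∷ ys) (suc m) (there c∈) (s≤s c≤m) | no c≢y = there (∈-take-firstPos ys m c∈ c≤m)

module _ {n t : ℕ} (G : Graph n) (v : Fin n) where

  blockedColours : Coloring n t → List (Fin t)
  blockedColours col = col v ∷ map col (filterᵇ (inN⁻ G v) (allFin n))

  length-blockedColours : ∀ col → length (blockedColours col) ≡ suc (boolCount (inN⁻ G v) (allFin n))
  length-blockedColours col =
    cong suc (trans (length-map col (filterᵇ (inN⁻ G v) (allFin n))) (length-filterᵇ (inN⁻ G v) (allFin n)))

  ∉blocked⇒Valid : ∀ {col c} → c ∉ blockedColours col → Valid G v col c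
  ∉blocked⇒Valid {col} c∉ =
    (λ c≡ → c∉ (here c≡)) ,
    (λ w w∈ c≡ → c∉ (there (subst (_∈ _) (sym c≡) (∈-map⁺ col (∈-filter⁺ (T? ∘ inN⁻ G v) (∈-allFin w) w∈)))))

  -- A best choice that reappears among the future colours was forced by the third rule, and then
  -- every colour is blocked or occurs in the future no later than the chosen one.
  BestChoice-∈⇒late : ∀ {β col c fut b} → c ≡ col v → BestChoice G β v col (c ∷ fut) b → b ∈ fut →
                      t ≤ suc (boolCount (inN⁻ G v) (allFin n)) + suc (firstPos b fut)
  BestChoice-∈⇒late c≡ (inj₁ (_ , β∉ , refl)) b∈ = ⊥-elim (β∉ (there b∈))
  BestChoice-∈⇒late c≡ (inj₂ (inj₁ (_ , _ , b∉))) b∈ = ⊥-elim (b∉ (there b∈))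
  BestChoice-∈⇒late {col = col} {c} {fut} {b} c≡ (inj₂ (inj₂ (noFresh , b-valid , b-latest))) b∈ = begin
    t                                                 ≤⟨ enumerates⇒≤length candidates covered ⟩
    length candidates                                 ≡⟨ length-++ (blockedColours col) ⟩
    length (blockedColours col) + length (take (suc p) fut)
      ≤⟨ +-mono-≤ (≤-reflexive (length-blockedColours col))
                  (≤-trans (≤-reflexive (length-take (suc p) fut)) (m⊓n≤m (suc p) _)) ⟩
    suc (boolCount (inN⁻ G v) (allFin n)) + suc p    ∎
    where
    open ≤-Reasoning
    p = firstPos b fut
    candidates = blockedColours col ++ take (suc p) fut
    valid≢c : ∀ {c'} → Valid G v col c' → c' ≢ c
    valid≢c c'-valid c'≡c = proj₁ c'-valid (trans c'≡c c≡)
    covered : ∀ c' → c' ∈ candidates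
    covered c' = by-cases (Any.any? (c' Fin.≟_) (blockedColours col))
      where
      by-cases : Dec (c' ∈ blockedColours col) → c' ∈ candidates
      by-cases (yes c'∈) = ∈-++⁺ˡ c'∈
      by-cases (no  c'∉) = ∈-++⁺ʳ (blockedColours col) (∈-take-firstPos fut p c'∈fut c'≤p)
        where
        c'-valid = ∉blocked⇒Valid c'∉
        c'∈fut : c' ∈ fut
        c'∈fut = ∈-∷-≢ (decidable-stable (Any.any? (c' Fin.≟_) (c ∷ fut))
                                         (λ c'∉ → noFresh (c' , c'-valid , c'∉)))
                       (valid≢c c'-valid)
        c'≤p : firstPos c' fut ≤ p
        c'≤p = s≤s⁻¹ (subst₂ _≤_ (firstPos-there fut (valid≢c c'-valid)) (firstPos-there fut (valid≢c b-valid))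
                                (b-latest c' c'-valid))

late⇒d≤ : ∀ {d m p} → 2 * d + 1 ≤ suc m + suc p → m ≤ d → d ≤ suc p
late⇒d≤ {d} {m} {p} late m≤d = +-cancelˡ-≤ (suc d) d (suc p) (begin
  suc (d + d)      ≡⟨ cong (λ x → suc (d + x)) (+-identityʳ d) ⟨
  suc (2 * d)      ≡⟨ +-comm 1 (2 * d) ⟩
  2 * d + 1        ≤⟨ late ⟩
  suc m + suc p    ≤⟨ +-monoˡ-≤ (suc p) (s≤s m≤d) ⟩
  suc d + suc p    ∎)
  where open ≤-Reasoning

-- Saved steps

ceilDiv-monoˡ-≤ : ∀ {m m'} d → m ≤ m' → ceilDiv m d ≤ ceilDiv m' d
ceilDiv-monoˡ-≤ zero    _    = z≤n
ceilDiv-monoˡ-≤ (suc k) m≤m' = /-monoˡ-≤ (suc k) (+-monoˡ-≤ k m≤m')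

ceilDiv-+ : ∀ {d} m → 1 ≤ d → ceilDiv (d + m) d ≡ suc (ceilDiv m d)
ceilDiv-+ {suc k} m _ = begin
  (suc k + m + k) / suc k                  ≡⟨ m/n≡1+[m∸n]/n (≤-trans (m≤m+n (suc k) m) (m≤m+n (suc k + m) k)) ⟩
  suc ((suc k + m + k ∸ suc k) / suc k)    ≡⟨ cong (λ x → suc ((x ∸ suc k) / suc k)) (+-assoc (suc k) m k) ⟩
  suc ((suc k + (m + k) ∸ suc k) / suc k)  ≡⟨ cong (λ x → suc (x / suc k)) (m+n∸m≡n (suc k) (m + k)) ⟩
  suc ((m + k) / suc k)                    ∎
  where open ≡-Reasoning

ceilDiv-pos : ∀ {d m} → 1 ≤ d → 1 ≤ m → 1 ≤ ceilDiv m d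
ceilDiv-pos {suc k} _ 1≤m = m≥n⇒m/n>0 (+-monoˡ-≤ k 1≤m)

module _ {A : Set} {P : A → Set} where

  Any-drop-take : ∀ xs {x ys} k l → k ≤ length xs → length xs < l → P x →
                  Any P (drop k (take l (xs ++ x ∷ ys)))
  Any-drop-take []       zero    (suc l) _          _          px = here px
  Any-drop-take (y ∷ xs) zero    (suc l) _          (s≤s xs<l) px = there (Any-drop-take xs 0 l z≤n xs<l px)
  Any-drop-take (y ∷ xs) (suc k) (suc l) (s≤s k≤xs) (s≤s xs<l) px = Any-drop-take xs k l k≤xs xs<l px

  Any-drop-++ : ∀ xs {ys} k → k ≤ length xs → Any P ys → Any P (drop k (xs ++ ys))
  Any-drop-++ []       zero    _          any = any
  Any-drop-++ (x ∷ xs) zero    _          any = there (Any-drop-++ xs 0 z≤n any)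
  Any-drop-++ (x ∷ xs) (suc k) (s≤s k≤xs) any = Any-drop-++ xs k k≤xs any

module Local {n t : ℕ} (G : Graph n) (d : ℕ) (v : Fin n) where

  isV isN⁻ : Step n t → Bool
  isV  s = proj₁ s == v
  isN⁻ s = inN⁻ G v (proj₁ s)

  AtV : Step n t → Set
  AtV s = proj₁ s ≡ v

  AllN⁻ : List (Step n t) → Set
  AllN⁻ = All (T ∘ isN⁻)

  local : List (Step n t) → List (Step n t)
  local = restrict (inN⁻[] G v)

  unsaved : List (Step n t) → ℕ → Step n t → Bool
  unsaved L j s = isN⁻ s ∧ not (savedAt G d v L j s)

  recolCount-local : ∀ S → recolCount v S ≡ boolCount isV (local S)
  recolCount-local S = trans (length-filterᵇ isV S)
    (sym (boolCount-filterᵇ (λ s s=v → subst (T ∘ inN⁻[] G v) (sym (==⇒≡ s=v)) (inN⁻[]-self G v)) S))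

  sumN⁻-local : ∀ S → sumN⁻ G v S ≡ boolCount isN⁻ (local S)
  sumN⁻-local S = begin
    sumN⁻ G v S                 ≡⟨ sum-map-allFin term ⟩
    ∑[ u < n ] term u           ≡⟨ ∑-recolCount (inN⁻ G v) S ⟩
    boolCount isN⁻ S            ≡⟨ boolCount-filterᵇ (λ _ → inN⁻⇒inN⁻[] G) S ⟨
    boolCount isN⁻ (local S)    ∎
    where
    open ≡-Reasoning
    term : Fin n → ℕ
    term u = if inN⁻ G v u then recolCount u S else 0

  savedCount-local : ∀ S → savedCount G d v S ≡ countFrom (savedAt G d v (local S)) 0 (local S)
  savedCount-local S =
    trans (boolCount-allFin (λ i → saved (toℕ i) (lookup (local S) i))) (∑-lookup saved (local S))
    where
    saved = savedAt G d v (local S)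

  sumN⁻∸savedCount : ∀ S → sumN⁻ G v S ∸ savedCount G d v S ≡ countFrom (unsaved (local S)) 0 (local S)
  sumN⁻∸savedCount S = begin
    sumN⁻ G v S ∸ savedCount G d v S           ≡⟨ cong₂ _∸_ (sumN⁻-local S) (savedCount-local S) ⟩
    boolCount isN⁻ L ∸ saved                   ≡⟨ cong (_∸ saved) (countFrom-const isN⁻ 0 L) ⟨
    countFrom (λ _ → isN⁻) 0 L ∸ saved         ≡⟨ cong (_∸ saved) (countFrom-+ split 0 L) ⟨
    saved + countFrom (unsaved L) 0 L ∸ saved  ≡⟨ m+n∸m≡n saved _ ⟩
    countFrom (unsaved L) 0 L                  ∎
    where
    open ≡-Reasoning
    L = local S
    saved = countFrom (savedAt G d v L) 0 L
    split : ∀ j s → 𝟙 (savedAt G d v L j s) + 𝟙 (unsaved L j s) ≡ 𝟙 (isN⁻ s)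
    split j s = 𝟙-∧-split (isN⁻ s) _

  -- The part of S_{|N⁻[v]} from some recolouring of v on, with k recolourings of v: consecutive ones
  -- are at least d neighbour steps apart, except that the closing one may come a single step later.
  data Spaced : ℕ → List (Step n t) → Set where
    last   : ∀ {b B} → AllN⁻ B → Spaced 1 ((v , b) ∷ B)
    closed : ∀ {b b' B} → AllN⁻ B → 1 ≤ length B → Spaced 2 ((v , b) ∷ B ++ (v , b') ∷ [])
    spaced : ∀ {b B k R} → AllN⁻ B → d ≤ length B → Spaced k R → Spaced (suc k) ((v , b) ∷ B ++ R)

  Spaced-AtV : ∀ {k R} → Spaced k R → Any AtV R
  Spaced-AtV (last _)       = here refl
  Spaced-AtV (closed _ _)   = here refl
  Spaced-AtV (spaced _ _ _) = here refl

  AllN⁻⇒no-isV : ∀ {B} → AllN⁻ B → boolCount isV B ≡ 0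
  AllN⁻⇒no-isV = boolCount-none ∘ All.map (λ s∈ s=v → inN⁻⇒≢ G s∈ (==⇒≡ s=v))

  v==v : 𝟙 (v == v) ≡ 1
  v==v = cong 𝟙 (==-refl v)

  isV-block : ∀ {b B} R → AllN⁻ B → boolCount isV ((v , b) ∷ B ++ R) ≡ suc (boolCount isV R)
  isV-block {b} {B} R B∈ = begin
    boolCount isV ((v , b) ∷ B ++ R)         ≡⟨ boolCount-∷ isV (v , b) (B ++ R) ⟩
    𝟙 (v == v) + boolCount isV (B ++ R)       ≡⟨ cong₂ _+_ v==v (boolCount-++ isV B R) ⟩
    1 + (boolCount isV B + boolCount isV R)   ≡⟨ cong (λ x → 1 + (x + boolCount isV R)) (AllN⁻⇒no-isV B∈) ⟩
    suc (boolCount isV R)                     ∎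
    where open ≡-Reasoning

  Spaced-isV : ∀ {k R} → Spaced k R → boolCount isV R ≡ k
  Spaced-isV (last {b} {B} B∈) = trans (boolCount-∷ isV (v , b) B) (cong₂ _+_ v==v (AllN⁻⇒no-isV B∈))
  Spaced-isV (closed {b} {b'} B∈ _) =
    trans (isV-block {b} ((v , b') ∷ []) B∈) (cong suc (Spaced-isV (last {b'} [])))
  Spaced-isV (spaced {b} {R = R} B∈ _ R-spaced) =
    trans (isV-block {b} R B∈) (cong suc (Spaced-isV R-spaced))

  noV-AtV : ∀ {L} → Any AtV L → noV v L ≡ false
  noV-AtV {(x , c) ∷ _} (here refl) rewrite ==-refl x = refl
  noV-AtV {s ∷ _} (there any) = trans (cong (not (proj₁ s == v) ∧_) (noV-AtV any)) (∧-zeroʳ _)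

  -- The last three hypotheses refute clauses (1), (2) and (3) of the definition of a saved step.
  unsaved-intro : ∀ {L j s} → T (isN⁻ s) →
                  Any AtV (take (suc j) L) → Any AtV (drop j L) → Any AtV (drop (j ∸ d) (take j L)) →
                  T (unsaved L j s)
  unsaved-intro {L} {j} {s} s∈ before after recent
    rewrite noV-AtV before | noV-AtV after | noV-AtV recent with isN⁻ s
  ... | true = _

  gap-unsaved : ∀ {L} P {b B} R → L ≡ P ++ (v , b) ∷ B ++ R → AllN⁻ B → Any AtV R →
                d ⊓ length B ≤ countFrom (unsaved L) (suc (length P)) B
  gap-unsaved P {b} {B} R refl B∈ R∋v = countFrom-≥ B∈ λ {m} {s} m<d m<B s∈ →
    unsaved-intro {s = s} s∈ (before m) (after m m<B) (recent m m<d)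
    where
    j : ℕ → ℕ
    j m = suc (length P) + m
    P<j : ∀ m → length P < j m
    P<j m = s≤s (m≤m+n (length P) m)
    before : ∀ m → Any AtV (take (suc (j m)) (P ++ (v , b) ∷ B ++ R))
    before m = Any-drop-take P 0 (suc (j m)) z≤n (m<n⇒m<1+n (P<j m)) refl
    after : ∀ m → m < length B → Any AtV (drop (j m) (P ++ (v , b) ∷ B ++ R))
    after m m<B = subst (Any AtV ∘ drop (j m)) (++-assoc P ((v , b) ∷ B) R)
      (Any-drop-++ (P ++ (v , b) ∷ B) (j m)
        (≤-trans (+-monoʳ-≤ (suc (length P)) (<⇒≤ m<B)) (≤-reflexive (trans (sym (+-suc (length P) (length B)))
                                                                        (sym (length-++ P)))))
        R∋v)
    recent : ∀ m → m < d → Any AtV (drop (j m ∸ d) (take (j m) (P ++ (v , b) ∷ B ++ R)))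
    recent m m<d = Any-drop-take P (j m ∸ d) (j m)
      (m≤n+o⇒m∸n≤o (j m) d (≤-trans (≤-reflexive (sym (+-suc (length P) m)))
                                    (≤-trans (+-monoʳ-≤ (length P) m<d) (≤-reflexive (+-comm (length P) d)))))
      (P<j m) refl

  Spaced-unsaved : ∀ {L k} P {R} → 1 ≤ d → L ≡ P ++ R → Spaced k R →
                   k ≤ 1 + ceilDiv (countFrom (unsaved L) (length P) R) d
  Spaced-unsaved P 1≤d L≡ (last _) = s≤s z≤n
  Spaced-unsaved {L} P 1≤d L≡ (closed {b} {b'} {B} B∈ 1≤B) = s≤s (ceilDiv-pos 1≤d (begin
    1                                                     ≤⟨ ⊓-glb 1≤d 1≤B ⟩
    d ⊓ length B                                          ≤⟨ gap-unsaved P ((v , b') ∷ []) L≡ B∈ (here refl) ⟩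
    countFrom (unsaved L) (suc (length P)) B              ≤⟨ m≤m+n _ _ ⟩
    countFrom (unsaved L) (suc (length P)) B + c'
                                                          ≤⟨ countFrom-∷-++ (unsaved L) (length P) (v , b) B final ⟩
    countFrom (unsaved L) (length P) ((v , b) ∷ B ++ final) ∎))
    where
    open ≤-Reasoning
    final = (v , b') ∷ []
    c' = countFrom (unsaved L) (suc (length P) + length B) final
  Spaced-unsaved {L} P 1≤d L≡ (spaced {b} {B} {k} {R} B∈ d≤B R-spaced) = s≤s (begin
    k                                                     ≤⟨ IH ⟩
    suc (ceilDiv c' d)                                    ≡⟨ ceilDiv-+ c' 1≤d ⟨
    ceilDiv (d + c') d                                    ≤⟨ ceilDiv-monoˡ-≤ d (+-monoˡ-≤ c' gap) ⟩
    ceilDiv (countFrom (unsaved L) (suc (length P)) B + c') d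
      ≤⟨ ceilDiv-monoˡ-≤ d (countFrom-∷-++ (unsaved L) (length P) (v , b) B R) ⟩
    ceilDiv (countFrom (unsaved L) (length P) ((v , b) ∷ B ++ R)) d ∎)
    where
    open ≤-Reasoning
    P' = P ++ (v , b) ∷ B
    c' = countFrom (unsaved L) (suc (length P) + length B) R
    gap : d ≤ countFrom (unsaved L) (suc (length P)) B
    gap = ≤-trans (≤-reflexive (sym (m≤n⇒m⊓n≡m d≤B))) (gap-unsaved P R L≡ B∈ (Spaced-AtV R-spaced))
    length-P' : length P' ≡ suc (length P) + length B
    length-P' = trans (length-++ P) (+-suc (length P) (length B))
    IH : k ≤ suc (ceilDiv c' d)
    IH = subst (λ i → k ≤ suc (ceilDiv (countFrom (unsaved L) i R) d)) length-P'
           (Spaced-unsaved P' 1≤d (trans L≡ (sym (++-assoc P ((v , b) ∷ B) R))) R-spaced)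

  Spaced-bound : ∀ {L} B {k R} → 1 ≤ d → L ≡ B ++ R → AllN⁻ B → Spaced k R →
                 boolCount isV L ≤ 1 + ceilDiv (countFrom (unsaved L) 0 L) d
  Spaced-bound {L} B {k} {R} 1≤d L≡ B∈ R-spaced = begin
    boolCount isV L                                       ≡⟨ cong (boolCount isV) L≡ ⟩
    boolCount isV (B ++ R)                                ≡⟨ boolCount-++ isV B R ⟩
    boolCount isV B + boolCount isV R
                                                          ≡⟨ cong₂ _+_ (AllN⁻⇒no-isV B∈) (Spaced-isV R-spaced) ⟩
    k                                                     ≤⟨ Spaced-unsaved B 1≤d L≡ R-spaced ⟩
    1 + ceilDiv (countFrom (unsaved L) (length B) R) d    ≤⟨ s≤s (ceilDiv-monoˡ-≤ d (m≤n+m _ _)) ⟩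
    1 + ceilDiv (countFrom (unsaved L) 0 B + countFrom (unsaved L) (length B) R) d
                                                          ≡⟨ cong (λ m → 1 + ceilDiv m d) (trans
                                                               (cong (countFrom (unsaved L) 0) L≡)
                                                               (countFrom-++ (unsaved L) 0 B R)) ⟨
    1 + ceilDiv (countFrom (unsaved L) 0 L) d             ∎
    where open ≤-Reasoning

-- The local best choice rule at v

module _ {n t : ℕ} (col : Coloring n t) (c : Fin t) where

  update-same : ∀ x → update col x c x ≡ c
  update-same x rewrite ==-refl x = refl

  update-other : ∀ {x y} → x ≢ y → update col x c y ≡ col y
  update-other {x} {y} x≢y with y == x in eq
  ... | true  = ⊥-elim (x≢y (sym (==⇒≡ (subst T (sym eq) _))))
  ... | false = refl

module _ {n t : ℕ} (G : Graph n) (v : Fin n) {x : Fin n} {c : Fin t} where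

  futureCols-accept : ∀ S → T (inN⁻ G v x) → futureCols G v ((x , c) ∷ S) ≡ c ∷ futureCols G v S
  futureCols-accept S x∈ = cong (map proj₂) (filter-accept (T? ∘ inN⁻ G v ∘ proj₁) x∈)

  futureCols-reject : ∀ S → ¬ T (inN⁻ G v x) → futureCols G v ((x , c) ∷ S) ≡ futureCols G v S
  futureCols-reject S x∉ = cong (map proj₂) (filter-reject (T? ∘ inN⁻ G v ∘ proj₁) x∉)

module LocalBestChoice {n d : ℕ} (G : Graph n) (β : Coloring n (2 * d + 1)) (v : Fin n)
                (|N⁻|≤d : boolCount (inN⁻ G v) (allFin n) ≤ d) where

  open Local {t = 2 * d + 1} G d v

  Steps : Set
  Steps = List (Step n (2 * d + 1))

  -- What follows the leading neighbour block B of the output. A recolouring of v caused by a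
  -- neighbour is inserted before a step giving that neighbour the current colour col v, so col v
  -- occurs among the future colours of the remaining input S, within the first |B| + 1 of them.
  data Tail (col : Coloring n (2 * d + 1)) (S B : Steps) : Steps → Set where
    none   : Tail col S B []
    final  : ∀ {b} → Tail col S B ((v , b) ∷ [])
    caused : ∀ {k R} → Spaced k R → col v ∈ futureCols G v S →
             firstPos (col v) (futureCols G v S) ≤ length B → Tail col S B R

  record Split (col : Coloring n (2 * d + 1)) (S S' : Steps) : Set where
    constructor split
    field
      block      : Steps
      rest       : Steps
      splits     : local S' ≡ block ++ rest
      block-N⁻   : AllN⁻ block
      tail       : Tail col S block rest

  split-hit : ∀ {col x c S S' b} → T (inN⁻ G v x) → c ≡ col v →
              BestChoice G β v col (futureCols G v ((x , c) ∷ S)) b →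
              Split (update (update col v b) x c) S S' → Split col ((x , c) ∷ S) ((v , b) ∷ (x , c) ∷ S')
  split-hit {col} {x} {c} {S} {S'} {b} x∈ c≡ best (split B R R≡ B∈ tl) = record
    { block      = []
    ; rest       = (v , b) ∷ (x , c) ∷ B ++ R
    ; splits     = trans (restrict-accept (inN⁻[] G v) ((x , c) ∷ S') (inN⁻[]-self G v))
                         (cong ((v , b) ∷_) (trans (restrict-accept (inN⁻[] G v) S' (inN⁻⇒inN⁻[] G x∈))
                                                   (cong ((x , c) ∷_) R≡)))
    ; block-N⁻   = []
    ; tail       = caused (proj₂ (next tl)) (subst (col v ∈_) (sym fut≡) (here (sym c≡)))
                          (≤-reflexive (trans (cong (firstPos (col v)) fut≡)
                                              (firstPos-here (futureCols G v S) (sym c≡))))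
    }
    where
    fut≡ : futureCols G v ((x , c) ∷ S) ≡ c ∷ futureCols G v S
    fut≡ = futureCols-accept G v S x∈
    col'v≡b : update (update col v b) x c v ≡ b
    col'v≡b = trans (update-other (update col v b) c (inN⁻⇒≢ G x∈)) (update-same col b v)
    next : Tail (update (update col v b) x c) S B R → Σ ℕ λ k → Spaced k ((v , b) ∷ ((x , c) ∷ B) ++ R)
    next none  = 1 , last (x∈ ∷ ++⁺ B∈ [])
    next final = 2 , closed (x∈ ∷ B∈) (s≤s z≤n)
    next (caused R-spaced b∈ b≤B) = _ , spaced (x∈ ∷ B∈) d≤1+B R-spaced
      where
      late = BestChoice-∈⇒late G v {β} c≡ (subst (λ f → BestChoice G β v col f b) fut≡ best)
                                      (subst (_∈ futureCols G v S) col'v≡b b∈)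
      d≤1+B : d ≤ suc (length B)
      d≤1+B = ≤-trans (late⇒d≤ late |N⁻|≤d)
                      (s≤s (subst (λ b' → firstPos b' (futureCols G v S) ≤ length B) col'v≡b b≤B))

  split-pass : ∀ {col x c S S'} → x ≢ v → ¬ (T (inN⁻ G v x) × c ≡ col v) →
               Split (update col x c) S S' → Split col ((x , c) ∷ S) ((x , c) ∷ S')
  split-pass {col} {x} {c} {S} {S'} x≢v no-hit (split B R R≡ B∈ tl) with T? (inN⁻ G v x)
  ... | yes x∈ = record
    { block      = (x , c) ∷ B
    ; rest       = R
    ; splits     = trans (restrict-accept (inN⁻[] G v) S' (inN⁻⇒inN⁻[] G x∈)) (cong ((x , c) ∷_) R≡)
    ; block-N⁻   = x∈ ∷ B∈
    ; tail       = shift tl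
    }
    where
    fut≡ = futureCols-accept G v {c = c} S x∈
    shift : Tail (update col x c) S B R → Tail col ((x , c) ∷ S) ((x , c) ∷ B) R
    shift none  = none
    shift final = final
    shift (caused R-spaced v∈ v≤B) = caused R-spaced
      (subst (col v ∈_) (sym fut≡) (there (subst (_∈ futureCols G v S) (update-other col c x≢v) v∈)))
      (≤-trans (≤-reflexive (trans (cong (firstPos (col v)) fut≡)
                                   (firstPos-there (futureCols G v S) (λ v≡c → no-hit (x∈ , sym v≡c)))))
               (s≤s (subst (λ c' → firstPos c' (futureCols G v S) ≤ length B) (update-other col c x≢v) v≤B)))
  ... | no x∉ = record
    { block      = B
    ; rest       = R
    ; splits     = trans (restrict-reject (inN⁻[] G v) S' x∉[]) R≡
    ; block-N⁻   = B∈
    ; tail       = shift tl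
    }
    where
    x∉[] : ¬ T (inN⁻[] G v x)
    x∉[] x∈[] with inN⁻[]-cases G {v} {x} x∈[]
    ... | inj₁ x∈  = x∉ x∈
    ... | inj₂ x≡v = x≢v x≡v
    fut≡ = futureCols-reject G v {c = c} S x∉
    shift : Tail (update col x c) S B R → Tail col ((x , c) ∷ S) B R
    shift none  = none
    shift final = final
    shift (caused R-spaced v∈ v≤B) = caused R-spaced
      (subst (col v ∈_) (sym fut≡) (subst (_∈ futureCols G v S) (update-other col c x≢v) v∈))
      (subst (λ f → firstPos (col v) f ≤ length B) (sym fut≡)
             (subst (λ c' → firstPos c' (futureCols G v S) ≤ length B) (update-other col c x≢v) v≤B))

  LBC-split : ∀ {col S S'} → LBC G β v col S S' → All (λ s → proj₁ s ≢ v) S → Split col S S'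
  LBC-split (end-ok _)           []            = split [] [] refl [] none
  LBC-split (end-recol _)        []            =
    split [] _ (restrict-accept (inN⁻[] G v) [] (inN⁻[]-self G v)) [] final
  LBC-split (hit x∈ c≡ best run) (_ ∷ avoid)   = split-hit x∈ c≡ best (LBC-split run avoid)
  LBC-split (pass no-hit run)    (x≢v ∷ avoid) = split-pass x≢v no-hit (LBC-split run avoid)

  Split-bound : ∀ {col S S' L} → 1 ≤ d → L ≡ local S' → Split col S S' →
                boolCount isV L ≤ 1 + ceilDiv (countFrom (unsaved L) 0 L) d
  Split-bound {L = L} 1≤d L≡ (split B [] splits B∈ none) = ≤-trans (≤-reflexive no-isV) z≤n
    where
    no-isV : boolCount isV L ≡ 0
    no-isV = begin
      boolCount isV L                    ≡⟨ cong (boolCount isV) (trans L≡ splits) ⟩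
      boolCount isV (B ++ [])            ≡⟨ boolCount-++ isV B [] ⟩
      boolCount isV B + 0                ≡⟨ cong (_+ 0) (AllN⁻⇒no-isV B∈) ⟩
      0                                  ∎
      where open ≡-Reasoning
  Split-bound 1≤d L≡ (split B _ splits B∈ final) = Spaced-bound B 1≤d (trans L≡ splits) B∈ (last [])
  Split-bound 1≤d L≡ (split B _ splits B∈ (caused R-spaced _ _)) =
    Spaced-bound B 1≤d (trans L≡ splits) B∈ R-spaced

lemma4p4 : {n : ℕ} (d : ℕ) → 3 ≤ d → (G : Graph n) → Degenerate d G → PEO G →
    (α β : Coloring n (2 * d + 1)) → Proper G α → Proper G β →
    (S : List (Step n (2 * d + 1))) → BCS G α β n S → (v : _) →
    recolCount v S ≤ 1 + ceilDiv (sumN⁻ G v S ∸ savedCount G d v S) d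
lemma4p4 {n} d 3≤d G deg peo α β _ _ S bcs v = begin
  recolCount v S                                      ≡⟨ recolCount-local S ⟩
  boolCount isV (local S)                             ≤⟨ Split-bound 1≤d restrict-≡ (LBC-split run input-avoids) ⟩
  1 + ceilDiv (countFrom (unsaved (local S)) 0 (local S)) d
                                                      ≡⟨ cong (λ m → 1 + ceilDiv m d) (sumN⁻∸savedCount S) ⟨
  1 + ceilDiv (sumN⁻ G v S ∸ savedCount G d v S) d     ∎
  where
  open ≤-Reasoning
  open Local {t = 2 * d + 1} G d v
  open LocalBestChoice G β v (|N⁻|≤d G deg peo v)
  open LocalRun (BCS-localRun G α β v bcs (toℕ<n v))
  1≤d : 1 ≤ d
  1≤d = ≤-trans (s≤s z≤n) 3≤d
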